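{- Let $n_0$ be an integer and let $\boldsymbol\beta=(\beta(n))_{n\ge n_0}$ be a strictly increasing sequence of integers $\ge n_0$ such that the set of integers $\ge n_0$ not in $\boldsymbol\beta$ is infinite. Then the Aronson transform of $\boldsymbol\beta$ exists and is unique. That is, the set of strictly increasing sequences $\boldsymbol\alpha=(\alpha(n))_{n\ge n_0}$ of integers $\ge n_0$ such that for every $n\ge n_0$, $n$ is a term of $\boldsymbol\alpha$ if and only if $\alpha(n)$ is a term of $\boldsymbol\beta$, is nonempty and has a lexicographically least element. Equivalently, choosing each $\alpha(n)$ (in order $n=n_0,n_0+1,\dots$) as the smallest integer $\ge n_0$ and greater than $\alpha(n-1)$ that is consistent with this condition never gets stuck and yields a well-defined infinite sequence satisfying the condition.
   Context: The Aronson transform of $\boldsymbol\beta$ is the sequence $\boldsymbol\alpha$ in which $\alpha(n)$ is the smallest integer greater than $\alpha(n-1)$ (and $\ge n_0$) consistent with the condition "$n$ is in $\boldsymbol\alpha$ if and only if $\alpha(n)$ is in $\boldsymbol\beta$". -}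

module Defs where

open import Data.Integer using (ℤ; _≤_; _<_)
open import Data.Product using (Σ; _×_; ∃-syntax)
open import Relation.Binary.PropositionalEquality using (_≡_)
open import Relation.Nullary using (¬_)

-- A sequence (s(n))_{n ≥ n0} of integers is modelled as a function ℤ → ℤ;
-- only its values at arguments n ≥ n0 are relevant.
Seq : Set
Seq = ℤ → ℤ

StrictlyIncreasing : ℤ → Seq → Set
StrictlyIncreasing n0 s = ∀ m n → n0 ≤ m → m < n → s m < s n

TermsAtLeast : ℤ → Seq → Set
TermsAtLeast n0 s = ∀ n → n0 ≤ n → n0 ≤ s n

IsTerm : ℤ → Seq → ℤ → Set
IsTerm n0 s x = ∃[ k ] (n0 ≤ k × s k ≡ x)

InfiniteComplement : ℤ → Seq → Set
InfiniteComplement n0 s = ∀ N → ∃[ m ] (N ≤ m × n0 ≤ m × ¬ IsTerm n0 s m)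

Admissible : ℤ → Seq → Seq → Set
Admissible n0 β α =
  StrictlyIncreasing n0 α × TermsAtLeast n0 α ×
  (∀ n → n0 ≤ n → (IsTerm n0 α n → IsTerm n0 β (α n)) × (IsTerm n0 β (α n) → IsTerm n0 α n))

-- lexicographic order on sequences indexed by n ≥ n0:
-- α ≤lex α'  iff at every index m ≥ n0 at which α and α' agree on all
-- earlier indices, α(m) ≤ α'(m).  (Classically equivalent to: α = α' or
-- α(m) < α'(m) at the first index m where they differ.)
LexLeq : ℤ → Seq → Seq → Set
LexLeq n0 α α' =
  ∀ m → n0 ≤ m → (∀ k → n0 ≤ k → k < m → α k ≡ α' k) → α m ≤ α' m

LexLeastAdmissible : ℤ → Seq → Seq → Set
LexLeastAdmissible n0 β α =
  Admissible n0 β α × (∀ α' → Admissible n0 β α' → LexLeq n0 α α')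

-- Since every admissible α has α(m) ≥ m,
-- the integer n can only be a term α(m) with m ≤ n; so at step n the condition
-- "n ∈ α ⇔ α(n) ∈ β" depends only on α(n) and on whether n is among the earlier terms.
-- A value fitting this condition always exists above α(n-1): a large term of β if n is
-- already a term, otherwise a large non-term of β (the complement is infinite).  Fitting
-- is decidable because β(m) ≥ m bounds the search for β-membership, so α(n) can be chosen
-- least.  The resulting α is admissible, and an admissible α' agreeing with α before n
-- makes α'(n) a fitting candidate at step n, whence α(n) ≤ α'(n).

module Submission where

open import Defs
open import Data.Integer using (ℤ)
open import Data.Product using (∃-syntax; _×_)

open import Data.Integer using (+_; 1ℤ; _+_; _-_; _⊔_; pred; ∣_∣; +≤+; +<+; _≤_; _<_) renaming (suc to sucℤ)
import Data.Integer.Properties as ℤ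
open import Data.Integer.Tactic.RingSolver using (solve-∀)
open import Data.List using (List; []; _∷_)
open import Data.List.Membership.Propositional using (_∈_)
open import Data.List.Membership.DecPropositional ℤ._≟_ using (_∈?_)
open import Data.List.Relation.Unary.Any using (here; there)
open import Data.Nat as ℕ using (ℕ; zero; suc; z≤n)
import Data.Nat.Properties as ℕ
open import Data.Product using (_,_; proj₁)
open import Data.Sum using (_⊎_; inj₁; inj₂; [_,_]′)
open import Data.Sum.Function.Propositional using (_⊎-⇔_)
open import Function using (_∘_)
open import Function.Bundles using (_⇔_; mk⇔; Equivalence)
import Function.Properties.Equivalence as ⇔
open import Level using (0ℓ)
open import Relation.Binary.PropositionalEquality using (_≡_; refl; sym; trans; cong; subst; subst₂)
open import Relation.Nullary using (¬_; Dec; yes; no; contradiction)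
open import Relation.Nullary.Decidable using (map′; _×-dec_; _→-dec_; _⊎-dec_)
open import Relation.Unary using (Pred; Decidable)

_⇔-dec_ : ∀ {A B : Set} → Dec A → Dec B → Dec (A ⇔ B)
A? ⇔-dec B? = map′ (λ (f , g) → mk⇔ f g) (λ e → Equivalence.to e , Equivalence.from e)
                   ((A? →-dec B?) ×-dec (B? →-dec A?))

module _ {P : Pred ℕ 0ℓ} (P? : Decidable P) where

  least-≤-or-none : ∀ n → (∃[ m ] (m ℕ.≤ n × P m × ∀ {k} → k ℕ.< m → ¬ P k))
                          ⊎ (∀ {k} → k ℕ.≤ n → ¬ P k)
  least-≤-or-none zero with P? zero
  ... | yes p = inj₁ (zero , z≤n , p , λ ())
  ... | no ¬p = inj₂ λ { z≤n → ¬p }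
  least-≤-or-none (suc n) with least-≤-or-none n
  ... | inj₁ (m , m≤n , p , below) = inj₁ (m , ℕ.m≤n⇒m≤1+n m≤n , p , below)
  ... | inj₂ none with P? (suc n)
  ...   | yes p = inj₁ (suc n , ℕ.≤-refl , p , none ∘ ℕ.≤-pred)
  ...   | no ¬p = inj₂ λ k≤1+n → [ none ∘ ℕ.≤-pred , (λ { refl → ¬p }) ]′ (ℕ.m≤n⇒m<n∨m≡n k≤1+n)

  least-witness : ∀ {n} → P n → ∃[ m ] (P m × ∀ {k} → P k → m ℕ.≤ k)
  least-witness {n} p with least-≤-or-none n
  ... | inj₁ (m , _ , pm , below) = m , pm , λ pk → ℕ.≮⇒≥ (λ k<m → below k<m pk)
  ... | inj₂ none = contradiction p (none ℕ.≤-refl)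

i+[j-i]≡j : ∀ i j → i + (j - i) ≡ j
i+[j-i]≡j = solve-∀

[i+j]-i≡j : ∀ i j → (i + j) - i ≡ j
[i+j]-i≡j = solve-∀

i≤j⇒i+∣j-i∣≡j : ∀ {i j} → i ≤ j → i + + ∣ j - i ∣ ≡ j
i≤j⇒i+∣j-i∣≡j {i} {j} i≤j =
  trans (cong (λ x → i + x) (ℤ.0≤i⇒+∣i∣≡i (ℤ.i≤j⇒0≤j-i i≤j))) (i+[j-i]≡j i j)

least-above : {P : Pred ℤ 0ℓ} → Decidable P → ∀ p {w} → p < w → P w →
              ∃[ v ] (p < v × P v × ∀ {u} → p < u → P u → v ≤ u)
least-above {P} P? p p<w pw =
  let m , pm , m-least = least-witness (P? ∘ from) (pull-back p<w pw)
  in  from m , ℤ.suc[i]≤j⇒i<j (ℤ.i≤i+j (sucℤ p) (+ m)) , pm ,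
      λ p<u pu → subst (from m ≤_) (from-onto p<u)
                   (ℤ.+-monoʳ-≤ (sucℤ p) (+≤+ (m-least (pull-back p<u pu))))
  where
  from : ℕ → ℤ
  from k = sucℤ p + + k

  from-onto : ∀ {u} → p < u → from ∣ u - sucℤ p ∣ ≡ u
  from-onto = i≤j⇒i+∣j-i∣≡j ∘ ℤ.i<j⇒suc[i]≤j

  pull-back : ∀ {u} → p < u → P u → P (from ∣ u - sucℤ p ∣)
  pull-back p<u = subst P (sym (from-onto p<u))

Increasing : (ℕ → ℤ) → Set
Increasing f = ∀ {i j} → i ℕ.< j → f i < f j

increasing-by-step : ∀ {f} → (∀ i → f i < f (suc i)) → Increasing f
increasing-by-step step {i} {suc j} i<1+j with ℕ.m≤n⇒m<n∨m≡n (ℕ.≤-pred i<1+j)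
... | inj₁ i<j  = ℤ.<-trans (increasing-by-step step i<j) (step j)
... | inj₂ refl = step i

Attains : (ℕ → ℤ) → ℤ → Set
Attains f x = ∃[ j ] f j ≡ x

AttainsBelow : (ℕ → ℤ) → ℕ → ℤ → Set
AttainsBelow f i x = ∃[ k ] (k ℕ.< i × f k ≡ x)

attainsBelow-cong : ∀ {f g i x} → (∀ {k} → k ℕ.< i → f k ≡ g k) →
                    AttainsBelow f i x ⇔ AttainsBelow g i x
attainsBelow-cong f≗g = mk⇔ (λ (k , k<i , e) → k , k<i , trans (sym (f≗g k<i)) e)
                            (λ (k , k<i , e) → k , k<i , trans (f≗g k<i) e)

module Indexing (n0 : ℤ) where

  idx : ℕ → ℤ
  idx i = n0 + + i

  n0≤idx : ∀ i → n0 ≤ idx i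
  n0≤idx i = ℤ.i≤i+j n0 (+ i)

  idx-mono-≤ : ∀ {i j} → i ℕ.≤ j → idx i ≤ idx j
  idx-mono-≤ = ℤ.+-monoʳ-≤ n0 ∘ +≤+

  idx-mono-< : ∀ {i j} → i ℕ.< j → idx i < idx j
  idx-mono-< = ℤ.+-monoʳ-< n0 ∘ +<+

  idx-cancel-≤ : ∀ {i j} → idx i ≤ idx j → i ℕ.≤ j
  idx-cancel-≤ le = ℕ.≮⇒≥ (λ j<i → ℤ.<⇒≱ (idx-mono-< j<i) le)

  idx-cancel-< : ∀ {i j} → idx i < idx j → i ℕ.< j
  idx-cancel-< lt = ℕ.≰⇒> (λ j≤i → ℤ.<⇒≱ lt (idx-mono-≤ j≤i))

  idx-suc : ∀ i → idx (suc i) ≡ sucℤ (idx i)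
  idx-suc i = trans (cong (λ x → n0 + x) (ℤ.pos-+ 1 i)) (x+[1+y]≡1+[x+y] n0 (+ i))
    where
    x+[1+y]≡1+[x+y] : ∀ x y → x + (1ℤ + y) ≡ 1ℤ + (x + y)
    x+[1+y]≡1+[x+y] = solve-∀

  ∣idx-n0∣≡ : ∀ i → ∣ idx i - n0 ∣ ≡ i
  ∣idx-n0∣≡ i = cong ∣_∣ ([i+j]-i≡j n0 (+ i))

  idx∣x-n0∣≡x : ∀ {x} → n0 ≤ x → idx ∣ x - n0 ∣ ≡ x
  idx∣x-n0∣≡x = i≤j⇒i+∣j-i∣≡j

  x≤idx∣x-n0∣ : ∀ x → x ≤ idx ∣ x - n0 ∣
  x≤idx∣x-n0∣ x with ℤ.≤-total n0 x
  ... | inj₁ n0≤x = ℤ.≤-reflexive (sym (idx∣x-n0∣≡x n0≤x))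
  ... | inj₂ x≤n0 = ℤ.≤-trans x≤n0 (n0≤idx _)

  -- Arguments x < n0 are folded back by ∣_∣; those values are irrelevant junk.
  extend : (ℕ → ℤ) → Seq
  extend f x = f ∣ x - n0 ∣

  extend-idx : ∀ f i → extend f (idx i) ≡ f i
  extend-idx f i = cong f (∣idx-n0∣≡ i)

  AboveIdx : (ℕ → ℤ) → Set
  AboveIdx f = ∀ i → idx i ≤ f i

  increasing⇒aboveIdx : ∀ {f} → Increasing f → n0 ≤ f 0 → AboveIdx f
  increasing⇒aboveIdx {f} f-inc n0≤f0 zero = subst (_≤ f 0) (sym (ℤ.+-identityʳ n0)) n0≤f0
  increasing⇒aboveIdx {f} f-inc n0≤f0 (suc i) =
    subst (_≤ f (suc i)) (sym (idx-suc i))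
      (ℤ.i<j⇒suc[i]≤j (ℤ.≤-<-trans (increasing⇒aboveIdx f-inc n0≤f0 i) (f-inc (ℕ.n<1+n i))))

  attains? : ∀ {f} → AboveIdx f → Decidable (Attains f)
  attains? {f} f-above x with least-≤-or-none (λ j → f j ℤ.≟ x) ∣ x - n0 ∣
  ... | inj₁ (j , _ , e , _) = yes (j , e)
  ... | inj₂ none = no λ (j , e) →
        none (idx-cancel-≤ (ℤ.≤-trans (subst (idx j ≤_) e (f-above j)) (x≤idx∣x-n0∣ x))) e

  attains-idx⇔ : ∀ {f} → AboveIdx f → ∀ i →
                 Attains f (idx i) ⇔ (AttainsBelow f i (idx i) ⊎ f i ≡ idx i)
  attains-idx⇔ {f} f-above i = mk⇔ split
    (λ { (inj₁ (k , _ , e)) → k , e ; (inj₂ e) → i , e })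
    where
    split : Attains f (idx i) → AttainsBelow f i (idx i) ⊎ f i ≡ idx i
    split (j , e) with ℕ.m≤n⇒m<n∨m≡n (idx-cancel-≤ (subst (idx j ≤_) e (f-above j)))
    ... | inj₁ j<i  = inj₁ (j , j<i , e)
    ... | inj₂ refl = inj₂ e

  isTerm⇔attains : ∀ {s x} → IsTerm n0 s x ⇔ Attains (s ∘ idx) x
  isTerm⇔attains {s} = mk⇔ (λ (k , n0≤k , e) → ∣ k - n0 ∣ , trans (cong s (idx∣x-n0∣≡x n0≤k)) e)
                           (λ (j , e) → idx j , n0≤idx j , e)

  isTerm-extend⇔attains : ∀ {f x} → IsTerm n0 (extend f) x ⇔ Attains f x
  isTerm-extend⇔attains {f} = mk⇔ (λ (k , _ , e) → ∣ k - n0 ∣ , e)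
                                  (λ (j , e) → idx j , n0≤idx j , trans (extend-idx f j) e)

  Admissibleᴺ : (ℕ → ℤ) → (ℕ → ℤ) → Set
  Admissibleᴺ b f = Increasing f × AboveIdx f × (∀ i → Attains f (idx i) ⇔ Attains b (f i))

  restrict-increasing : ∀ {s} → StrictlyIncreasing n0 s → Increasing (s ∘ idx)
  restrict-increasing s-inc i<j = s-inc _ _ (n0≤idx _) (idx-mono-< i<j)

  restrict-aboveIdx : ∀ {s} → StrictlyIncreasing n0 s → TermsAtLeast n0 s → AboveIdx (s ∘ idx)
  restrict-aboveIdx s-inc s-≥ = increasing⇒aboveIdx (restrict-increasing s-inc) (s-≥ _ (n0≤idx 0))

  restrict-coinfinite : ∀ {s} → InfiniteComplement n0 s → ∀ N → ∃[ m ] (N ≤ m × ¬ Attains (s ∘ idx) m)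
  restrict-coinfinite s-coinf N =
    let m , N≤m , _ , ¬term = s-coinf N in m , N≤m , ¬term ∘ Equivalence.from isTerm⇔attains

  restrict-admissible : ∀ {β s} → Admissible n0 β s → Admissibleᴺ (β ∘ idx) (s ∘ idx)
  restrict-admissible (s-inc , s-≥ , s-consistent) =
    restrict-increasing s-inc , restrict-aboveIdx s-inc s-≥ , λ i →
      let to , from = s-consistent (idx i) (n0≤idx i)
      in  ⇔.trans (⇔.sym isTerm⇔attains) (⇔.trans (mk⇔ to from) isTerm⇔attains)

  extend-admissible : ∀ {β f} → Admissibleᴺ (β ∘ idx) f → Admissible n0 β (extend f)
  extend-admissible {β} {f} (f-inc , f-above , f-consistent) = increasing , terms≥ , consistent
    where
    increasing : StrictlyIncreasing n0 (extend f)
    increasing m n n0≤m m<n = f-inc (idx-cancel-< (subst₂ _<_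
      (sym (idx∣x-n0∣≡x n0≤m)) (sym (idx∣x-n0∣≡x (ℤ.≤-trans n0≤m (ℤ.<⇒≤ m<n)))) m<n))

    terms≥ : TermsAtLeast n0 (extend f)
    terms≥ n _ = ℤ.≤-trans (n0≤idx _) (f-above _)

    consistent : ∀ n → n0 ≤ n → (IsTerm n0 (extend f) n → IsTerm n0 β (extend f n)) ×
                                (IsTerm n0 β (extend f n) → IsTerm n0 (extend f) n)
    consistent n n0≤n = Equivalence.to C , Equivalence.from C
      where
      C : IsTerm n0 (extend f) n ⇔ IsTerm n0 β (extend f n)
      C = ⇔.trans isTerm-extend⇔attains
            (⇔.trans (subst (λ x → Attains f x ⇔ Attains (β ∘ idx) (extend f n))
                            (idx∣x-n0∣≡x n0≤n) (f-consistent ∣ n - n0 ∣))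
                     (⇔.sym isTerm⇔attains))

  extend-lexLeq : ∀ {f s} → (∀ i → (∀ {k} → k ℕ.< i → f k ≡ s (idx k)) → f i ≤ s (idx i)) →
                  LexLeq n0 (extend f) s
  extend-lexLeq {f} {s} least m n0≤m agree =
    subst (f ∣ m - n0 ∣ ≤_) (cong s (idx∣x-n0∣≡x n0≤m)) (least ∣ m - n0 ∣ λ {k} k<i →
      trans (sym (extend-idx f k))
            (agree (idx k) (n0≤idx k) (subst (idx k <_) (idx∣x-n0∣≡x n0≤m) (idx-mono-< k<i))))

  module Greedy (b : ℕ → ℤ) (b-above : AboveIdx b)
                (b-coinfinite : ∀ N → ∃[ m ] (N ≤ m × ¬ Attains b m)) where

    -- S records whether idx i is among the earlier terms.  No later term can equal idx i,
    -- so S ⊎ v ≡ idx i says whether idx i is a term once v is taken as the i-th one.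
    Fits : Set → ℕ → ℤ → Set
    Fits S i v = (S ⊎ v ≡ idx i) ⇔ Attains b v

    fits? : ∀ {S} → Dec S → ∀ i → Decidable (Fits S i)
    fits? S? i v = (S? ⊎-dec (v ℤ.≟ idx i)) ⇔-dec attains? b-above v

    fits-cong : ∀ {S T i v} → S ⇔ T → Fits S i v → Fits T i v
    fits-cong S⇔T = ⇔.trans (⇔.sym (S⇔T ⊎-⇔ ⇔.refl))

    fits⇒consistent : ∀ {f} → AboveIdx f → ∀ i →
                      Fits (AttainsBelow f i (idx i)) i (f i) → Attains f (idx i) ⇔ Attains b (f i)
    fits⇒consistent f-above i = ⇔.trans (attains-idx⇔ f-above i)

    consistent⇒fits : ∀ {f} → AboveIdx f → ∀ i →
                      Attains f (idx i) ⇔ Attains b (f i) → Fits (AttainsBelow f i (idx i)) i (f i)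
    consistent⇒fits f-above i = ⇔.trans (⇔.sym (attains-idx⇔ f-above i))

    fit-above : ∀ {S} → Dec S → ∀ i p → ∃[ w ] (p < w × Fits S i w)
    fit-above (yes s) i p =
      b j , ℤ.<-≤-trans (ℤ.suc[i]≤j⇒i<j (x≤idx∣x-n0∣ (sucℤ p))) (b-above j) ,
      mk⇔ (λ _ → j , refl) (λ _ → inj₁ s)
      where
      j = ∣ sucℤ p - n0 ∣
    fit-above (no ¬s) i p =
      let m , N≤m , ¬attains = b-coinfinite (sucℤ (p ⊔ idx i))
          below-m : ∀ {y} → y ≤ p ⊔ idx i → y < m
          below-m y≤ = ℤ.suc[i]≤j⇒i<j (ℤ.≤-trans (ℤ.suc-mono y≤) N≤m)
      in  m , below-m (ℤ.i≤i⊔j p (idx i)) ,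
          mk⇔ (λ { (inj₁ s) → contradiction s ¬s
                 ; (inj₂ m≡i) → contradiction (sym m≡i) (ℤ.<⇒≢ (below-m (ℤ.i≤j⊔i p (idx i)))) })
              (λ t → contradiction t ¬attains)

    previous : List ℤ → ℤ
    previous []      = pred n0  -- forces the first term to be ≥ n0
    previous (v ∷ _) = v

    least-fit : ∀ i seen → ∃[ v ] (previous seen < v × Fits (idx i ∈ seen) i v ×
                              ∀ {u} → previous seen < u → Fits (idx i ∈ seen) i u → v ≤ u)
    least-fit i seen =
      let w , prev<w , w-fits = fit-above (idx i ∈? seen) i (previous seen)
      in  least-above (fits? (idx i ∈? seen) i) (previous seen) prev<w w-fits

    history : ℕ → List ℤ
    history zero    = []
    history (suc i) = proj₁ (least-fit i (history i)) ∷ history i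

    a : ℕ → ℤ
    a i = proj₁ (least-fit i (history i))

    a-above-previous : ∀ i → previous (history i) < a i
    a-above-previous i = let _ , prev<a , _ = least-fit i (history i) in prev<a

    a-fits : ∀ i → Fits (idx i ∈ history i) i (a i)
    a-fits i = let _ , _ , fits , _ = least-fit i (history i) in fits

    a-least : ∀ i {u} → previous (history i) < u → Fits (idx i ∈ history i) i u → a i ≤ u
    a-least i = let _ , _ , _ , least = least-fit i (history i) in least

    ∈-history⇒attainsBelow : ∀ {i x} → x ∈ history i → AttainsBelow a i x
    ∈-history⇒attainsBelow {suc i} (here x≡a) = i , ℕ.n<1+n i , sym x≡a
    ∈-history⇒attainsBelow {suc i} (there x∈) =
      let k , k<i , e = ∈-history⇒attainsBelow x∈ in k , ℕ.m<n⇒m<1+n k<i , e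

    attainsBelow⇒∈-history : ∀ {i x} → AttainsBelow a i x → x ∈ history i
    attainsBelow⇒∈-history {suc i} (k , k<1+i , e) with ℕ.m≤n⇒m<n∨m≡n (ℕ.≤-pred k<1+i)
    ... | inj₁ k<i  = there (attainsBelow⇒∈-history (k , k<i , e))
    ... | inj₂ refl = here (sym e)

    ∈-history⇔attainsBelow : ∀ {i x} → x ∈ history i ⇔ AttainsBelow a i x
    ∈-history⇔attainsBelow = mk⇔ ∈-history⇒attainsBelow attainsBelow⇒∈-history

    a-increasing : Increasing a
    a-increasing = increasing-by-step (a-above-previous ∘ suc)

    a-aboveIdx : AboveIdx a
    a-aboveIdx = increasing⇒aboveIdx a-increasing
                   (subst (_≤ a 0) (ℤ.suc-pred n0) (ℤ.i<j⇒suc[i]≤j (a-above-previous 0)))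

    a-admissible : Admissibleᴺ b a
    a-admissible = a-increasing , a-aboveIdx , λ i →
      fits⇒consistent a-aboveIdx i (fits-cong ∈-history⇔attainsBelow (a-fits i))

    a-lexLeast : ∀ {f} → Admissibleᴺ b f → ∀ i → (∀ {k} → k ℕ.< i → a k ≡ f k) → a i ≤ f i
    a-lexLeast {f} (f-inc , f-above , f-consistent) i agree = a-least i (previous<f i agree)
      (fits-cong (⇔.trans (⇔.sym (attainsBelow-cong agree)) (⇔.sym ∈-history⇔attainsBelow))
                 (consistent⇒fits f-above i (f-consistent i)))
      where
      previous<f : ∀ i → (∀ {k} → k ℕ.< i → a k ≡ f k) → previous (history i) < f i
      previous<f zero    _     = ℤ.<-≤-trans (ℤ.i≤pred[j]⇒i<j ℤ.≤-refl) (ℤ.≤-trans (n0≤idx 0) (f-above 0))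
      previous<f (suc i) agree = subst (_< f (suc i)) (sym (agree (ℕ.n<1+n i))) (f-inc (ℕ.n<1+n i))

theorem2 : (n0 : ℤ) (β : Seq) →
    StrictlyIncreasing n0 β → TermsAtLeast n0 β → InfiniteComplement n0 β →
    ∃[ α ] LexLeastAdmissible n0 β α
theorem2 n0 β β-inc β-≥ β-coinf =
  extend a , extend-admissible a-admissible ,
  λ α' α'-admissible → extend-lexLeq (a-lexLeast (restrict-admissible α'-admissible))
  where
  open Indexing n0
  open Greedy (β ∘ idx) (restrict-aboveIdx β-inc β-≥) (restrict-coinfinite β-coinf)
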